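{- Consider an application of Res to query pair clauses $C=\lnot A_1\lor\dots\lor\lnot A_n\lor D$ (main premise), $C_1=B_1\lor D_1,\dots,C_t=B_t\lor D_t$ (side premises), with mgu $\sigma$ satisfying $A_i\sigma=B_i\sigma$ for $1\le i\le t$. Then: (1) $\sigma$ assigns to each top variable either a simple non-ground compound term (variable depth exactly $1$) or a ground term; (2) $\sigma$ assigns to each non-top variable of the main premise either a variable or a ground term; (3) $\sigma$ assigns to each variable of the side premises either a variable or a ground term.
   Context: Variable depth: $vdp(t)=-1$ if $t$ ground, $0$ if $t$ a variable, $1+\max_i vdp(u_i)$ for non-ground $f(u_1,\dots,u_n)$. Flat: $vdp\le0$; simple: $vdp\le1$. A non-ground compound literal contains a non-ground compound term. A compound term $t$ is weakly covering if $var(s)=var(t)$ for each non-ground compound subterm $s$; a literal $L$ is weakly covering if each argument is ground, a variable, or weakly covering $t$ with $var(t)=var(L)$. Query pair: atoms $\overline A=A_1,\dots,A_n$ and weakly covering atoms $\overline B=B_1,\dots,B_n$ with (1) $\overline A$ flat and non-ground, $\overline B$ simple; (2) each $B_i$ a non-ground compound literal or ground; (3) $var(\overline A)\cap var(\overline B)=\emptyset$, $B_i$ pairwise variable-disjoint; (4) a simultaneous mgu $\sigma_0$ with $A_i\sigma_0=B_i\sigma_0$ for all $i$. Query pair clauses: $C=\lnot A_1\lor\dots\lor\lnot A_n\lor D$ ($D$ flat), $C_i=B_i\lor D_i$ ($D_i$ simple). Top variable: $x\in var(\overline A)$ with $vdp(x\sigma_0)\ge vdp(y\sigma_0)$ for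 all $y\in var(\overline A)$. Res: reorder so that $A_1,\dots,A_t$ ($1\le t\le n$) are exactly the atoms containing at least one top variable; with $\sigma$ an mgu of $A_i=B_i$ for $i\le t$, derive from $C,C_1,\dots,C_t$ the resolvent $(D_1\lor\dots\lor D_t\lor\lnot A_{t+1}\lor\dots\lor\lnot A_n\lor D)\sigma$. -}

module Defs where

open import Data.Nat using (ℕ; zero; suc; _⊔_)
open import Data.Integer using (ℤ; +_; -[1+_]; _≤_)
open import Data.Fin using (Fin)
open import Data.List using (List; []; _∷_)
open import Data.List.Membership.Propositional using (_∈_)
open import Data.Maybe using (Maybe; just; nothing)
open import Data.Product using (Σ; ∃; _×_; _,_)
open import Data.Sum using (_⊎_)
open import Data.Empty using (⊥)
open import Data.Unit using (⊤)
import Data.Fin as Fin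
open import Relation.Nullary using (¬_)
open import Relation.Binary.PropositionalEquality using (_≡_; _≢_)

-- First-order terms over function symbols F, variables ℕ.
-- (Arities are not tracked: a symbol may be applied to any list of
--  arguments; this only generalises the usual setting.)

data Term (F : Set) : Set where
  var : ℕ → Term F
  fn  : F → List (Term F) → Term F

toℤ : Maybe ℕ → ℤ
toℤ nothing = -[1+ 0 ]
toℤ (just n) = + n

module _ {F : Set} where

  data _∈v_ (x : ℕ) : Term F → Set where
    here  : x ∈v var x
    there : ∀ {f ts u} → x ∈v u → u ∈ ts → x ∈v fn f ts

  data _⊑_ (s : Term F) : Term F → Set where
    refl⊑ : s ⊑ s
    sub   : ∀ {f ts u} → s ⊑ u → u ∈ ts → s ⊑ fn f ts

  Ground : Term F → Set
  Ground t = ∀ x → ¬ (x ∈v t)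

  IsVar : Term F → Set
  IsVar t = ∃ λ x → t ≡ var x

  IsCompound : Term F → Set
  IsCompound t = ∃ λ f → ∃ λ ts → t ≡ fn f ts

  SameVars : Term F → Term F → Set
  SameVars s t = ∀ x → (x ∈v s → x ∈v t) × (x ∈v t → x ∈v s)

  -- variable depth; internally `nothing` encodes -1 (ground)

  _⊔ₘ_ : Maybe ℕ → Maybe ℕ → Maybe ℕ
  nothing ⊔ₘ m = m
  just a ⊔ₘ nothing = just a
  just a ⊔ₘ just b = just (a ⊔ b)

  mutual
    vdpM : Term F → Maybe ℕ
    vdpM (var x) = just 0
    vdpM (fn f ts) with vdpMs ts
    ... | nothing = nothing
    ... | just d  = just (suc d)

    vdpMs : List (Term F) → Maybe ℕ
    vdpMs [] = nothing
    vdpMs (t ∷ ts) = vdpM t ⊔ₘ vdpMs ts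

  vdp : Term F → ℤ
  vdp t = toℤ (vdpM t)

  Subst : Set
  Subst = ℕ → Term F

  mutual
    _[_] : Term F → Subst → Term F
    var x [ σ ] = σ x
    fn f ts [ σ ] = fn f (ts [ σ ]*)

    _[_]* : List (Term F) → Subst → List (Term F)
    [] [ σ ]* = []
    (t ∷ ts) [ σ ]* = t [ σ ] ∷ ts [ σ ]*

record Atom (F P : Set) : Set where
  constructor _⦅_⦆
  field
    pred : P
    args : List (Term F)
open Atom public

data Literal (F P : Set) : Set where
  pos : Atom F P → Literal F P
  neg : Atom F P → Literal F P

Clause : Set → Set → Set
Clause F P = List (Literal F P)

module _ {F P : Set} where

  atomOf : Literal F P → Atom F P
  atomOf (pos A) = A
  atomOf (neg A) = A

  _[_]ᵃ : Atom F P → Subst {F} → Atom F P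
  (p ⦅ ts ⦆) [ σ ]ᵃ = p ⦅ ts [ σ ]* ⦆

  _∈vA_ : ℕ → Atom F P → Set
  x ∈vA A = ∃ λ t → t ∈ args A × x ∈v t

  _∈vL_ : ℕ → Literal F P → Set
  x ∈vL L = x ∈vA atomOf L

  _∈vC_ : ℕ → Clause F P → Set
  x ∈vC C = ∃ λ L → L ∈ C × x ∈vL L

  GroundA : Atom F P → Set
  GroundA A = ∀ x → ¬ (x ∈vA A)

  vdpA : Atom F P → ℤ
  vdpA A = toℤ (vdpMs (args A))

  vdpL : Literal F P → ℤ
  vdpL L = vdpA (atomOf L)

  FlatA : Atom F P → Set
  FlatA A = vdpA A ≤ + 0

  SimpleA : Atom F P → Set
  SimpleA A = vdpA A ≤ + 1

  FlatC : Clause F P → Set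
  FlatC C = ∀ L → L ∈ C → vdpL L ≤ + 0

  SimpleC : Clause F P → Set
  SimpleC C = ∀ L → L ∈ C → vdpL L ≤ + 1

  NonGroundCompoundA : Atom F P → Set
  NonGroundCompoundA A =
    ∃ λ t → t ∈ args A × ∃ λ s → s ⊑ t × IsCompound s × ¬ Ground s

  WeaklyCoveringT : Term F → Set
  WeaklyCoveringT t =
    IsCompound t × (∀ s → s ⊑ t → IsCompound s → ¬ Ground s → SameVars s t)

  WeaklyCoveringA : Atom F P → Set
  WeaklyCoveringA A = ∀ t → t ∈ args A →
      Ground t ⊎ IsVar t
    ⊎ (WeaklyCoveringT t × (∀ x → (x ∈v t → x ∈vA A) × (x ∈vA A → x ∈v t)))

module _ {F P : Set} where

  Unifies : ∀ {n} → (Fin n → Set) → (Fin n → Atom F P) → (Fin n → Atom F P)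
          → Subst {F} → Set
  Unifies S A B σ = ∀ i → S i → A i [ σ ]ᵃ ≡ B i [ σ ]ᵃ

  IsMGU : ∀ {n} → (Fin n → Set) → (Fin n → Atom F P) → (Fin n → Atom F P)
        → Subst {F} → Set
  IsMGU S A B σ = Unifies S A B σ ×
    (∀ θ → Unifies S A B θ → ∃ λ η → ∀ x → θ x ≡ (σ x) [ η ])

  _∈v̅_ : ∀ {n} → ℕ → (Fin n → Atom F P) → Set
  x ∈v̅ A = ∃ λ i → x ∈vA A i

  record QueryPair (n : ℕ) (A B : Fin n → Atom F P) (σ₀ : Subst {F}) : Set where
    field
      A-flat        : ∀ i → FlatA (A i)
      A-nonground   : ∃ λ x → x ∈v̅ A
      B-simple      : ∀ i → SimpleA (B i)
      B-wcov        : ∀ i → WeaklyCoveringA (B i)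
      B-shape       : ∀ i → NonGroundCompoundA (B i) ⊎ GroundA (B i)
      AB-disjoint   : ∀ x → x ∈v̅ A → ¬ (x ∈v̅ B)
      B-disjoint    : ∀ i j → i ≢ j → ∀ x → x ∈vA B i → ¬ (x ∈vA B j)
      σ₀-mgu        : IsMGU (λ _ → ⊤) A B σ₀

  Top : ∀ {n} → (Fin n → Atom F P) → Subst {F} → ℕ → Set
  Top A σ₀ x = x ∈v̅ A × (∀ y → y ∈v̅ A → vdp (σ₀ y) ≤ vdp (σ₀ x))

  -- A i contains at least one top variable (i.e. i ∈ {1,…,t})
  HasTop : ∀ {n} → (Fin n → Atom F P) → Subst {F} → Fin n → Set
  HasTop A σ₀ i = ∃ λ x → x ∈vA A i × Top A σ₀ x

  mainClause : ∀ {n} → (Fin n → Atom F P) → Clause F P → Clause F P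
  mainClause {zero}  A D = D
  mainClause {suc n} A D = neg (A Fin.zero) ∷ mainClause (λ i → A (Fin.suc i)) D

  sideClause : Atom F P → Clause F P → Clause F P
  sideClause B D = pos B ∷ D

module Submission where

-- Let d be the largest depth vdp (σ₀ y) of a variable y of A̅, so the top variables are those of
-- depth d. Since A̅ is flat and B̅ simple and weakly covering, when d ≥ 0 a top variable x can only
-- be matched against an argument f(c̅) of some Bᵢ whose arguments are ground or variables and
-- which contains every variable of Bᵢ; all variables of Bᵢ then have depth < d, and a variable of
-- A̅ matched against such an f(c̅) is top. Hence collapsing, in σ, the value of each top variable
-- to f applied to the flattened arguments and every other non-ground compound value to a
-- variable still unifies the top pairs. By generality of σ this collapse is an instance of σ,
-- which is only possible if σ is already flat off the top variables; then σ x = f(c̅σ) has depth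
-- 1 or is ground. When d = -1, σ turns out to be ground on var(A̅) and the same collapse applies.

open import Defs
open import Data.Nat as ℕ using (ℕ; suc; z≤n; s≤s)
import Data.Nat.Properties as ℕ
open import Data.Integer as ℤ using (+_; -≤-; -≤+; +≤+)
open import Data.Fin as Fin using (Fin)
import Data.Fin.Properties as Fin
open import Data.List using (List; []; _∷_; _++_; map; concatMap; allFin)
open import Data.List.Membership.Propositional using (_∈_; lose; find)
open import Data.List.Membership.Propositional.Properties
  using (∈-++⁺ˡ; ∈-++⁺ʳ; ∈-++⁻; ∈-map⁺; ∈-map⁻; ∈-concatMap⁺; ∈-concatMap⁻; ∈-allFin)
open import Data.List.Relation.Unary.Any using (here; there)
open import Data.List.Relation.Unary.Any.Properties using (¬Any[])
import Data.List.Relation.Unary.All as All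
open import Data.List.Properties using (map-id-local; map-cong-local; map-∘)
open import Data.List.Relation.Binary.Pointwise as Pointwise
  using (Pointwise; []; _∷_; ≡⇒Pointwise-≡; Pointwise-≡⇒≡)
open import Data.Maybe as Maybe using (Maybe; nothing; just)
open import Data.Product using (∃; _×_; _,_; proj₁; proj₂)
open import Data.Sum using (_⊎_; inj₁; inj₂; swap)
open import Data.Empty using (⊥-elim)
open import Data.Unit using (⊤; tt)
open import Function using (_∘_)
open import Relation.Binary.Bundles using (TotalOrder)
import Relation.Binary.Reasoning.PartialOrder
open import Relation.Nullary using (¬_; Dec; yes; no)
open import Relation.Nullary.Decidable using (_×-dec_; map′)
open import Data.List.Membership.DecPropositional ℕ._≟_ using (_∈?_)
open import Relation.Binary.PropositionalEquality
  using (_≡_; refl; sym; trans; cong; cong₂; subst; module ≡-Reasoning)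
open import Relation.Binary.Construct.Add.Infimum.NonStrict ℕ._≤_
  using (_≤₋_; ⊥₋≤_; ≤₋-dec; ≤₋-isTotalOrder-≡) renaming ([_] to just≤just)

≤₋-totalOrder : TotalOrder _ _ _
≤₋-totalOrder = record { isTotalOrder = ≤₋-isTotalOrder-≡ ℕ.≤-isTotalOrder }

module ≤₋-Reasoning = Relation.Binary.Reasoning.PartialOrder (TotalOrder.poset ≤₋-totalOrder)

open TotalOrder ≤₋-totalOrder using ()
  renaming (refl to ≤₋-refl; trans to ≤₋-trans)

suc₋ : Maybe ℕ → Maybe ℕ
suc₋ = Maybe.map suc

n≤₋suc₋n : ∀ a → a ≤₋ suc₋ a
n≤₋suc₋n nothing = ⊥₋≤ nothing
n≤₋suc₋n (just a) = just≤just (ℕ.n≤1+n a)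

suc₋-mono : ∀ {a b} → a ≤₋ b → suc₋ a ≤₋ suc₋ b
suc₋-mono (⊥₋≤ b) = ⊥₋≤ suc₋ b
suc₋-mono (just≤just p) = just≤just (s≤s p)

just≤₋⇒suc₋≰₋just : ∀ {d a} → just d ≤₋ a → ¬ (suc₋ a ≤₋ just d)
just≤₋⇒suc₋≰₋just (just≤just p) (just≤just q) = ℕ.1+n≰n (ℕ.≤-trans q p)

just≰₋nothing : ∀ {d} → ¬ (just d ≤₋ nothing)
just≰₋nothing ()

toℤ-mono-≤ : ∀ {a b} → a ≤₋ b → toℤ a ℤ.≤ toℤ b
toℤ-mono-≤ (⊥₋≤ nothing) = -≤- z≤n
toℤ-mono-≤ (⊥₋≤ just b) = -≤+
toℤ-mono-≤ (just≤just p) = +≤+ p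

toℤ-cancel-≤ : ∀ a b → toℤ a ℤ.≤ toℤ b → a ≤₋ b
toℤ-cancel-≤ nothing b _ = ⊥₋≤ b
toℤ-cancel-≤ (just a) (just b) (+≤+ p) = just≤just p

module ⊔₋-Properties (F : Set) where

  -- Defs' `_⊔ₘ_` carries an implicit `F` that it never uses.
  infixl 6 _⊔₋_
  _⊔₋_ : Maybe ℕ → Maybe ℕ → Maybe ℕ
  _⊔₋_ = _⊔ₘ_ {F}

  ⊔₋-upperˡ : ∀ a b → a ≤₋ a ⊔₋ b
  ⊔₋-upperˡ nothing b = ⊥₋≤ b
  ⊔₋-upperˡ (just a) nothing = ≤₋-refl
  ⊔₋-upperˡ (just a) (just b) = just≤just (ℕ.m≤m⊔n a b)

  ⊔₋-upperʳ : ∀ a b → b ≤₋ a ⊔₋ b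
  ⊔₋-upperʳ nothing b = ≤₋-refl
  ⊔₋-upperʳ (just a) nothing = ⊥₋≤ just a
  ⊔₋-upperʳ (just a) (just b) = just≤just (ℕ.m≤n⊔m a b)

  ⊔₋-lub : ∀ {a b c} → a ≤₋ c → b ≤₋ c → a ⊔₋ b ≤₋ c
  ⊔₋-lub (⊥₋≤ _) q = q
  ⊔₋-lub (just≤just p) (⊥₋≤ _) = just≤just p
  ⊔₋-lub (just≤just p) (just≤just q) = just≤just (ℕ.⊔-lub p q)

  suc₋-distrib-⊔₋ : ∀ a b → suc₋ (a ⊔₋ b) ≡ suc₋ a ⊔₋ suc₋ b
  suc₋-distrib-⊔₋ nothing b = refl
  suc₋-distrib-⊔₋ (just a) nothing = refl
  suc₋-distrib-⊔₋ (just a) (just b) = refl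

∅⊎inhabited : ∀ {P : ℕ → Set} (xs : List ℕ) →
              (∀ {x} → P x → x ∈ xs) → (∀ {x} → x ∈ xs → P x) → (∀ x → ¬ P x) ⊎ ∃ P
∅⊎inhabited [] listed _ = inj₁ (λ x p → ¬Any[] (listed p))
∅⊎inhabited (x ∷ _) _ enumerated = inj₂ (x , enumerated (here refl))

module _ {F : Set} where

  open ⊔₋-Properties F

  infix 4 _∈vᴸ_
  _∈vᴸ_ : ℕ → List (Term F) → Set
  x ∈vᴸ ts = ∃ λ u → u ∈ ts × x ∈v u

  mutual
    vars : Term F → List ℕ
    vars (var x) = x ∷ []
    vars (fn f ts) = varsᴸ ts

    varsᴸ : List (Term F) → List ℕ
    varsᴸ [] = []
    varsᴸ (t ∷ ts) = vars t ++ varsᴸ ts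

  mutual
    ∈v⇒∈vars : ∀ {x t} → x ∈v t → x ∈ vars t
    ∈v⇒∈vars here = here refl
    ∈v⇒∈vars (there p m) = ∈vᴸ⇒∈varsᴸ (_ , m , p)

    ∈vᴸ⇒∈varsᴸ : ∀ {x ts} → x ∈vᴸ ts → x ∈ varsᴸ ts
    ∈vᴸ⇒∈varsᴸ (_ , here refl , p) = ∈-++⁺ˡ (∈v⇒∈vars p)
    ∈vᴸ⇒∈varsᴸ {ts = t ∷ _} (u , there m , p) = ∈-++⁺ʳ (vars t) (∈vᴸ⇒∈varsᴸ (u , m , p))

  mutual
    ∈vars⇒∈v : ∀ {x} t → x ∈ vars t → x ∈v t
    ∈vars⇒∈v (var x) (here refl) = here
    ∈vars⇒∈v (fn f ts) m with ∈varsᴸ⇒∈vᴸ ts m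
    ... | u , u∈ts , p = there p u∈ts

    ∈varsᴸ⇒∈vᴸ : ∀ {x} ts → x ∈ varsᴸ ts → x ∈vᴸ ts
    ∈varsᴸ⇒∈vᴸ (t ∷ ts) m with ∈-++⁻ (vars t) m
    ... | inj₁ p = t , here refl , ∈vars⇒∈v t p
    ... | inj₂ p with ∈varsᴸ⇒∈vᴸ ts p
    ...   | u , u∈ts , q = u , there u∈ts , q

  ground⊎occurs : ∀ t → Ground t ⊎ ∃ (_∈v t)
  ground⊎occurs t = ∅⊎inhabited (vars t) ∈v⇒∈vars (∈vars⇒∈v t)

  ∈v-⊑ : ∀ {s t : Term F} {x} → s ⊑ t → x ∈v s → x ∈v t
  ∈v-⊑ refl⊑ p = p
  ∈v-⊑ (sub s⊑u u∈ts) p = there (∈v-⊑ s⊑u p) u∈ts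

  ⊑var⇒≡ : ∀ {s : Term F} {y} → s ⊑ var y → s ≡ var y
  ⊑var⇒≡ refl⊑ = refl

  ∈v-var⇒≡ : ∀ {x y} → x ∈v var {F} y → x ≡ y
  ∈v-var⇒≡ here = refl

  []*≡map : ∀ ts (σ : Subst {F}) → ts [ σ ]* ≡ map (_[ σ ]) ts
  []*≡map [] σ = refl
  []*≡map (t ∷ ts) σ = cong (t [ σ ] ∷_) ([]*≡map ts σ)

  ∈-[]*⁺ : ∀ {u ts} (σ : Subst {F}) → u ∈ ts → u [ σ ] ∈ ts [ σ ]*
  ∈-[]*⁺ {ts = ts} σ m = subst (_ ∈_) (sym ([]*≡map ts σ)) (∈-map⁺ (_[ σ ]) m)

  ∈-[]*⁻ : ∀ {w} ts (σ : Subst {F}) → w ∈ ts [ σ ]* → ∃ λ u → u ∈ ts × w ≡ u [ σ ]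
  ∈-[]*⁻ ts σ m = ∈-map⁻ (_[ σ ]) (subst (_ ∈_) ([]*≡map ts σ) m)

  mutual
    []-cong : ∀ t {σ τ : Subst {F}} → (∀ x → x ∈v t → σ x ≡ τ x) → t [ σ ] ≡ t [ τ ]
    []-cong (var x) eq = eq x here
    []-cong (fn f ts) eq = cong (fn f) ([]*-cong ts (λ x (u , m , p) → eq x (there p m)))

    []*-cong : ∀ ts {σ τ : Subst {F}} → (∀ x → x ∈vᴸ ts → σ x ≡ τ x) → ts [ σ ]* ≡ ts [ τ ]*
    []*-cong [] eq = refl
    []*-cong (t ∷ ts) eq =
      cong₂ _∷_ ([]-cong t (λ x p → eq x (t , here refl , p)))
                ([]*-cong ts (λ x (u , m , p) → eq x (u , there m , p)))

  mutual
    []-identity : ∀ (t : Term F) → t [ var ] ≡ t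
    []-identity (var x) = refl
    []-identity (fn f ts) = cong (fn f) ([]*-identity ts)

    []*-identity : ∀ (ts : List (Term F)) → ts [ var ]* ≡ ts
    []*-identity [] = refl
    []*-identity (t ∷ ts) = cong₂ _∷_ ([]-identity t) ([]*-identity ts)

  ground⇒[]≡ : ∀ {t : Term F} (σ : Subst {F}) → Ground t → t [ σ ] ≡ t
  ground⇒[]≡ {t} σ g = trans ([]-cong t (λ x p → ⊥-elim (g x p))) ([]-identity t)

  ≡ground-[] : ∀ {t u : Term F} (σ : Subst {F}) → Ground u → t ≡ u [ σ ] → Ground t
  ≡ground-[] σ g refl = subst Ground (sym (ground⇒[]≡ σ g)) g

  ∈v-[]⁺ : ∀ t {σ : Subst {F}} {x y} → x ∈v t → y ∈v σ x → y ∈v (t [ σ ])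
  ∈v-[]⁺ (var x) here q = q
  ∈v-[]⁺ (fn f ts) {σ} (there {u = u} p m) q = there (∈v-[]⁺ u p q) (∈-[]*⁺ σ m)

  ∈v-[]⁻ : ∀ t {σ : Subst {F}} {y} → y ∈v (t [ σ ]) → ∃ λ x → x ∈v t × y ∈v σ x
  ∈v-[]⁻ (var x) q = x , here , q
  ∈v-[]⁻ (fn f ts) {σ} (there q m) with ∈-[]*⁻ ts σ m
  ... | u , u∈ts , refl with ∈v-[]⁻ u q
  ...   | x , p , r = x , there p u∈ts , r

  ground-[]⁻ : ∀ t {σ : Subst {F}} {x} → Ground (t [ σ ]) → x ∈v t → Ground (σ x)
  ground-[]⁻ t g p y q = g y (∈v-[]⁺ t p q)

  vdpM-fn : ∀ f (ts : List (Term F)) → vdpM (fn f ts) ≡ suc₋ (vdpMs ts)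
  vdpM-fn f ts with vdpMs ts
  ... | nothing = refl
  ... | just d = refl

  vdpM≤vdpMs : ∀ {u : Term F} {ts} → u ∈ ts → vdpM u ≤₋ vdpMs ts
  vdpM≤vdpMs {ts = t ∷ ts} (here refl) = ⊔₋-upperˡ (vdpM t) (vdpMs ts)
  vdpM≤vdpMs {ts = t ∷ ts} (there m) = ≤₋-trans (vdpM≤vdpMs m) (⊔₋-upperʳ (vdpM t) (vdpMs ts))

  vdpMs-lub : ∀ (ts : List (Term F)) {d} → (∀ u → u ∈ ts → vdpM u ≤₋ d) → vdpMs ts ≤₋ d
  vdpMs-lub [] {d} _ = ⊥₋≤ d
  vdpMs-lub (t ∷ ts) h = ⊔₋-lub (h t (here refl)) (vdpMs-lub ts (λ u m → h u (there m)))

  suc₋-vdpMs-lub : ∀ (ts : List (Term F)) {d} → (∀ u → u ∈ ts → suc₋ (vdpM u) ≤₋ d) →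
                   suc₋ (vdpMs ts) ≤₋ d
  suc₋-vdpMs-lub [] {d} _ = ⊥₋≤ d
  suc₋-vdpMs-lub (t ∷ ts) {d} h =
    subst (_≤₋ d) (sym (suc₋-distrib-⊔₋ (vdpM t) (vdpMs ts)))
      (⊔₋-lub (h t (here refl)) (suc₋-vdpMs-lub ts (λ u m → h u (there m))))

  vdpM-[]-mono : ∀ (t : Term F) {σ : Subst {F}} {x} → x ∈v t → vdpM (σ x) ≤₋ vdpM (t [ σ ])
  vdpM-[]-mono (var x) here = ≤₋-refl
  vdpM-[]-mono (fn f ts) {σ} (there {u = u} p m) rewrite vdpM-fn f (ts [ σ ]*) =
    ≤₋-trans (vdpM-[]-mono u p) (≤₋-trans (vdpM≤vdpMs (∈-[]*⁺ σ m)) (n≤₋suc₋n _))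

  vdpM-[]-strict : ∀ f (ts : List (Term F)) {σ : Subst {F}} {x} → x ∈v fn f ts →
                   suc₋ (vdpM (σ x)) ≤₋ vdpM (fn f ts [ σ ])
  vdpM-[]-strict f ts {σ} (there {u = u} p m) rewrite vdpM-fn f (ts [ σ ]*) =
    suc₋-mono (≤₋-trans (vdpM-[]-mono u p) (vdpM≤vdpMs (∈-[]*⁺ σ m)))

  vdpM≡nothing⇒ground : ∀ (t : Term F) → vdpM t ≡ nothing → Ground t
  vdpM≡nothing⇒ground t eq x p with vdpM-[]-mono t {var} p
  ... | le rewrite []-identity t | eq = just≰₋nothing le

  mutual
    ground⇒vdpM≡nothing : ∀ (t : Term F) → Ground t → vdpM t ≡ nothing
    ground⇒vdpM≡nothing (var x) g = ⊥-elim (g x here)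
    ground⇒vdpM≡nothing (fn f ts) g
      rewrite vdpM-fn f ts | ground⇒vdpMs≡nothing ts (λ x (u , m , p) → g x (there p m)) = refl

    ground⇒vdpMs≡nothing : ∀ (ts : List (Term F)) → (∀ x → ¬ x ∈vᴸ ts) → vdpMs ts ≡ nothing
    ground⇒vdpMs≡nothing [] g = refl
    ground⇒vdpMs≡nothing (t ∷ ts) g
      rewrite ground⇒vdpM≡nothing t (λ x p → g x (t , here refl , p))
            | ground⇒vdpMs≡nothing ts (λ x (u , m , p) → g x (u , there m , p)) = refl

  vdpM≤0⇒ground⊎var : ∀ (t : Term F) → vdpM t ≤₋ just 0 → Ground t ⊎ IsVar t
  vdpM≤0⇒ground⊎var (var x) _ = inj₂ (x , refl)
  vdpM≤0⇒ground⊎var (fn f ts) le with vdpMs ts in eq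
  ... | nothing = inj₁ (vdpM≡nothing⇒ground (fn f ts) (trans (vdpM-fn f ts) (cong suc₋ eq)))
  vdpM≤0⇒ground⊎var (fn f ts) (just≤just ()) | just d

  ground⊎var⇒vdpM≤0 : ∀ (t : Term F) → Ground t ⊎ IsVar t → vdpM t ≤₋ just 0
  ground⊎var⇒vdpM≤0 t (inj₁ g) rewrite ground⇒vdpM≡nothing t g = ⊥₋≤ just 0
  ground⊎var⇒vdpM≤0 .(var x) (inj₂ (x , refl)) = ≤₋-refl

  vdpM≤1⇒args-ground⊎var : ∀ f (cs : List (Term F)) {c} → vdpM (fn f cs) ≤₋ just 1 → c ∈ cs →
                           Ground c ⊎ IsVar c
  vdpM≤1⇒args-ground⊎var f cs {c} le m = vdpM≤0⇒ground⊎var c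
    (≤₋-trans (vdpM≤vdpMs m) (pred₋ (vdpMs cs) (subst (_≤₋ just 1) (vdpM-fn f cs) le)))
    where pred₋ : ∀ a → suc₋ a ≤₋ just 1 → a ≤₋ just 0
          pred₋ nothing _ = ⊥₋≤ just 0
          pred₋ (just a) (just≤just (s≤s p)) = just≤just p

  args-ground⊎var⇒vdpM≡1 : ∀ f (ts : List (Term F)) → (∀ c → c ∈ ts → Ground c ⊎ IsVar c) →
                           ¬ Ground (fn f ts) → vdpM (fn f ts) ≡ just 1
  args-ground⊎var⇒vdpM≡1 f ts flat ng
    with vdpMs ts in eq | vdpMs-lub ts (λ c m → ground⊎var⇒vdpM≤0 c (flat c m))
  ... | nothing | _ =
    ⊥-elim (ng (vdpM≡nothing⇒ground (fn f ts) (trans (vdpM-fn f ts) (cong suc₋ eq))))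
  ... | just 0 | _ = refl
  ... | just (suc d) | just≤just ()

  vdpM-[]-shallow : ∀ f (cs : List (Term F)) (σ : Subst {F}) →
    (∀ c → c ∈ cs → Ground c ⊎ IsVar c) → (∀ w → var w ∈ cs → Ground (σ w) ⊎ IsVar (σ w)) →
    ¬ Ground (fn f cs [ σ ]) → vdpM (fn f cs [ σ ]) ≡ just 1
  vdpM-[]-shallow f cs σ flat flat-σ = args-ground⊎var⇒vdpM≡1 f (cs [ σ ]*) flat-image
    where
      flat-image : ∀ u → u ∈ cs [ σ ]* → Ground u ⊎ IsVar u
      flat-image _ m with ∈-[]*⁻ cs σ m
      ... | c , c∈ , refl with flat c c∈
      ...   | inj₁ gc = inj₁ (≡ground-[] σ gc refl)
      ...   | inj₂ (w , refl) = flat-σ w c∈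

  vdpM-[]-shallow≤compound : ∀ f (cs : List (Term F)) t {σ : Subst {F}} →
    (∀ c → c ∈ cs → Ground c ⊎ IsVar c) → IsCompound t → (∀ x → x ∈v fn f cs → x ∈v t) →
    vdpM (fn f cs [ σ ]) ≤₋ vdpM (t [ σ ])
  vdpM-[]-shallow≤compound f cs .(fn g ds) {σ} flat (g , ds , refl) covered
    rewrite vdpM-fn f (cs [ σ ]*) = suc₋-vdpMs-lub (cs [ σ ]*) below
    where
      below : ∀ u → u ∈ cs [ σ ]* → suc₋ (vdpM u) ≤₋ vdpM (fn g ds [ σ ])
      below u m with ∈-[]*⁻ cs σ m
      ... | c , c∈cs , refl with flat c c∈cs
      ...   | inj₁ gc rewrite ground⇒[]≡ σ gc | ground⇒vdpM≡nothing c gc = ⊥₋≤ _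
      ...   | inj₂ (w , refl) = vdpM-[]-strict g ds (covered w (there here c∈cs))

  flatten : Term F → Term F
  flatten (var x) = var x
  flatten (fn f ts) with ground⊎occurs (fn f ts)
  ... | inj₁ _ = fn f ts
  ... | inj₂ _ = var 0

  flatten₁ : Term F → Term F
  flatten₁ (var x) = var x
  flatten₁ (fn f ts) = fn f (map flatten ts)

  flatten-ground : ∀ (t : Term F) → Ground t → flatten t ≡ t
  flatten-ground (var x) g = ⊥-elim (g x here)
  flatten-ground (fn f ts) g with ground⊎occurs (fn f ts)
  ... | inj₁ _ = refl
  ... | inj₂ (x , p) = ⊥-elim (g x p)

  flatten₁-ground : ∀ (t : Term F) → Ground t → flatten₁ t ≡ t
  flatten₁-ground (var x) g = refl
  flatten₁-ground (fn f ts) g =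
    cong (fn f) (map-id-local (All.tabulate (λ {u} m → flatten-ground u (λ x p → g x (there p m)))))

  flatten-instance : ∀ (t : Term F) (η : Subst {F}) → flatten t ≡ t [ η ] → IsVar t ⊎ Ground t
  flatten-instance (var x) η _ = inj₁ (x , refl)
  flatten-instance (fn f ts) η eq with ground⊎occurs (fn f ts)
  flatten-instance (fn f ts) η eq | inj₁ g = inj₂ g
  flatten-instance (fn f ts) η () | inj₂ _

  []-flatten₁ : ∀ f (cs : List (Term F)) {σ θ : Subst {F}} →
    (∀ c → c ∈ cs → c [ θ ] ≡ flatten (c [ σ ])) → fn f cs [ θ ] ≡ flatten₁ (fn f cs [ σ ])
  []-flatten₁ f cs {σ} {θ} eq = cong (fn f) (begin
    cs [ θ ]*                       ≡⟨ []*≡map cs θ ⟩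
    map (_[ θ ]) cs                 ≡⟨ map-cong-local (All.tabulate (λ {c} → eq c)) ⟩
    map (flatten ∘ _[ σ ]) cs       ≡⟨ map-∘ cs ⟩
    map flatten (map (_[ σ ]) cs)   ≡⟨ cong (map flatten) (sym ([]*≡map cs σ)) ⟩
    map flatten (cs [ σ ]*)         ∎)
    where open ≡-Reasoning

  flattenOn : {V : ℕ → Set} → (∀ v → Dec (V v)) → Subst {F} → Subst {F}
  flattenOn V? σ v with V? v
  ... | yes _ = flatten₁ (σ v)
  ... | no _ = flatten (σ v)

  module _ {V : ℕ → Set} (V? : ∀ v → Dec (V v)) (σ : Subst {F}) where

    flattenOn-∈ : ∀ {v} → V v → flattenOn V? σ v ≡ flatten₁ (σ v)
    flattenOn-∈ {v} p with V? v
    ... | yes _ = refl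
    ... | no ¬p = ⊥-elim (¬p p)

    flattenOn-∉ : ∀ {v} → ¬ V v → flattenOn V? σ v ≡ flatten (σ v)
    flattenOn-∉ {v} ¬p with V? v
    ... | yes p = ⊥-elim (¬p p)
    ... | no _ = refl

    flattenOn-ground : ∀ {v} → Ground (σ v) → flattenOn V? σ v ≡ σ v
    flattenOn-ground {v} g with V? v
    ... | yes _ = flatten₁-ground (σ v) g
    ... | no _ = flatten-ground (σ v) g

    flattenOn-[]-ground : ∀ t → Ground (t [ σ ]) → t [ flattenOn V? σ ] ≡ t [ σ ]
    flattenOn-[]-ground t g = []-cong t (λ x p → flattenOn-ground (ground-[]⁻ t g p))

module _ {A B : Set} where

  Pointwise-∈ : ∀ {R : A → B → Set} {as bs a} → Pointwise R as bs → a ∈ as → ∃ λ b → b ∈ bs × R a b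
  Pointwise-∈ (r ∷ _) (here refl) = _ , here refl , r
  Pointwise-∈ (_ ∷ rs) (there m) with Pointwise-∈ rs m
  ... | b , b∈bs , r = b , there b∈bs , r

  Pointwise-zip : ∀ {R S : A → B → Set} {as bs} → Pointwise R as bs → Pointwise S as bs →
                  Pointwise (λ a b → R a b × S a b) as bs
  Pointwise-zip [] [] = []
  Pointwise-zip (r ∷ rs) (s ∷ ss) = (r , s) ∷ Pointwise-zip rs ss

  Pointwise-map-∈ : ∀ {R S : A → B → Set} {as bs} → (∀ {a b} → a ∈ as → b ∈ bs → R a b → S a b) →
                    Pointwise R as bs → Pointwise S as bs
  Pointwise-map-∈ h [] = []
  Pointwise-map-∈ h (r ∷ rs) =
    h (here refl) (here refl) r ∷ Pointwise-map-∈ (λ a b → h (there a) (there b)) rs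

module _ {F P : Set} where

  ∈vA? : ∀ x (A : Atom F P) → Dec (x ∈vA A)
  ∈vA? x A = map′ (∈varsᴸ⇒∈vᴸ (args A)) ∈vᴸ⇒∈varsᴸ (x ∈? varsᴸ (args A))

  ∈v̅? : ∀ {n} x (A : Fin n → Atom F P) → Dec (x ∈v̅ A)
  ∈v̅? x A = Fin.any? (λ i → ∈vA? x (A i))

  groundA⊎occurs : ∀ (A : Atom F P) → GroundA A ⊎ ∃ (_∈vA A)
  groundA⊎occurs A = ∅⊎inhabited (varsᴸ (args A)) ∈vᴸ⇒∈varsᴸ (∈varsᴸ⇒∈vᴸ (args A))

  GroundA? : ∀ (A : Atom F P) → Dec (GroundA A)
  GroundA? A with groundA⊎occurs A
  ... | inj₁ g = yes g
  ... | inj₂ (x , p) = no (λ g → g x p)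

  []ᵃ-cong : ∀ (A : Atom F P) {σ τ : Subst {F}} → (∀ x → x ∈vA A → σ x ≡ τ x) → A [ σ ]ᵃ ≡ A [ τ ]ᵃ
  []ᵃ-cong A eq = cong (pred A ⦅_⦆) ([]*-cong (args A) eq)

  groundA⇒[]ᵃ≡ : ∀ (A : Atom F P) (σ : Subst {F}) → GroundA A → A [ σ ]ᵃ ≡ A
  groundA⇒[]ᵃ≡ A σ g =
    trans ([]ᵃ-cong A (λ x p → ⊥-elim (g x p))) (cong (pred A ⦅_⦆) ([]*-identity (args A)))

  ArgsUnified : Subst {F} → Atom F P → Atom F P → Set
  ArgsUnified σ A B = Pointwise (λ a b → a [ σ ] ≡ b [ σ ]) (args A) (args B)

  []ᵃ≡⇒ArgsUnified : ∀ {A B : Atom F P} σ → A [ σ ]ᵃ ≡ B [ σ ]ᵃ → ArgsUnified σ A B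
  []ᵃ≡⇒ArgsUnified {A} {B} σ eq = Pointwise.map⁻ (_[ σ ]) (_[ σ ]) (≡⇒Pointwise-≡ (begin
    map (_[ σ ]) (args A)  ≡⟨ sym ([]*≡map (args A) σ) ⟩
    args A [ σ ]*          ≡⟨ cong args eq ⟩
    args B [ σ ]*          ≡⟨ []*≡map (args B) σ ⟩
    map (_[ σ ]) (args B)  ∎))
    where open ≡-Reasoning

  ArgsUnified⇒[]ᵃ≡ : ∀ {A B : Atom F P} σ → pred A ≡ pred B → ArgsUnified σ A B →
                     A [ σ ]ᵃ ≡ B [ σ ]ᵃ
  ArgsUnified⇒[]ᵃ≡ {A} {B} σ p≡ args≡ = cong₂ _⦅_⦆ p≡ (begin
    args A [ σ ]*          ≡⟨ []*≡map (args A) σ ⟩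
    map (_[ σ ]) (args A)  ≡⟨ Pointwise-≡⇒≡ (Pointwise.map⁺ (_[ σ ]) (_[ σ ]) args≡) ⟩
    map (_[ σ ]) (args B)  ≡⟨ sym ([]*≡map (args B) σ) ⟩
    args B [ σ ]*          ∎)
    where open ≡-Reasoning

  neg∈mainClause : ∀ {n} (A : Fin n → Atom F P) D i → neg (A i) ∈ mainClause A D
  neg∈mainClause {suc n} A D Fin.zero = here refl
  neg∈mainClause {suc n} A D (Fin.suc i) = there (neg∈mainClause (A ∘ Fin.suc) D i)

  ∈v̅⇒∈vC-mainClause : ∀ {n x} (A : Fin n → Atom F P) D → x ∈v̅ A → x ∈vC mainClause A D
  ∈v̅⇒∈vC-mainClause A D (i , p) = neg (A i) , neg∈mainClause A D i , p

  mgu-flattenOn : ∀ {n} {S : Fin n → Set} {A B : Fin n → Atom F P} {V : ℕ → Set}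
    (V? : ∀ v → Dec (V v)) {σ : Subst {F}} → IsMGU S A B σ → Unifies S A B (flattenOn V? σ) →
    ∀ v → ¬ V v → IsVar (σ v) ⊎ Ground (σ v)
  mgu-flattenOn V? {σ} (_ , general) unifies v ¬p with general _ unifies
  ... | η , θ≡ση = flatten-instance (σ v) η (trans (sym (flattenOn-∉ V? σ ¬p)) (θ≡ση v))

module QueryPairAnalysis {F P : Set} {n : ℕ} {A B : Fin n → Atom F P} {σ₀ : Subst {F}}
  (qp : QueryPair n A B σ₀) {σ : Subst {F}} (mgu : IsMGU (HasTop A σ₀) A B σ) where

  open QueryPair qp
  open import Data.List.Extrema ≤₋-totalOrder using (argmax; argmax-all; f[xs]≤f[argmax])

  depth₀ : ℕ → Maybe ℕ
  depth₀ v = vdpM (σ₀ v)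

  σ₀-args : ∀ i → ArgsUnified σ₀ (A i) (B i)
  σ₀-args i = []ᵃ≡⇒ArgsUnified σ₀ (proj₁ σ₀-mgu i tt)

  σ₀σ-args : ∀ i → HasTop A σ₀ i →
    Pointwise (λ a b → a [ σ₀ ] ≡ b [ σ₀ ] × a [ σ ] ≡ b [ σ ]) (args (A i)) (args (B i))
  σ₀σ-args i h = Pointwise-zip (σ₀-args i) ([]ᵃ≡⇒ArgsUnified σ (proj₁ mgu i h))

  A-arg-ground⊎var : ∀ i {a} → a ∈ args (A i) → Ground a ⊎ IsVar a
  A-arg-ground⊎var i m =
    vdpM≤0⇒ground⊎var _ (≤₋-trans (vdpM≤vdpMs m) (toℤ-cancel-≤ _ (just 0) (A-flat i)))

  var∈A-args : ∀ i {x} → x ∈vA A i → var x ∈ args (A i)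
  var∈A-args i (t , m , p) with A-arg-ground⊎var i m
  ... | inj₁ g = ⊥-elim (g _ p)
  ... | inj₂ (y , refl) rewrite ∈v-var⇒≡ p = m

  B-var∉A : ∀ i {w} → w ∈vA B i → ¬ w ∈v̅ A
  B-var∉A i p q = AB-disjoint _ q (i , p)

  data Covering (i : Fin n) : Term F → Set where
    covering : ∀ f cs → ¬ Ground (fn f cs) → (∀ c → c ∈ cs → Ground c ⊎ IsVar c) →
               (∀ x → x ∈vA B i → x ∈v fn f cs) → Covering i (fn f cs)

  data Shape (i : Fin n) : Term F → Set where
    ground-arg   : ∀ {b} → Ground b → Shape i b
    var-arg      : ∀ u → Shape i (var u)
    covering-arg : ∀ {b} → Covering i b → Shape i b

  shape : ∀ i {b} → b ∈ args (B i) → Shape i b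
  shape i {b} m with B-wcov i b m
  ... | inj₁ g = ground-arg g
  ... | inj₂ (inj₁ (u , refl)) = var-arg u
  ... | inj₂ (inj₂ (((f , cs , refl) , _) , same)) with ground⊎occurs (fn f cs)
  ...   | inj₁ g = ground-arg g
  ...   | inj₂ (x , p) = covering-arg (covering f cs (λ g → g x p) flat (λ y q → proj₂ (same y) q))
    where
      flat : ∀ c → c ∈ cs → Ground c ⊎ IsVar c
      flat c = vdpM≤1⇒args-ground⊎var f cs
                 (≤₋-trans (vdpM≤vdpMs m) (toℤ-cancel-≤ _ (just 1) (B-simple i)))

  varsᴬ : Fin n → List ℕ
  varsᴬ i = varsᴸ (args (A i))

  A-vars : List ℕ
  A-vars = concatMap varsᴬ (allFin n)

  ∈v̅⇒∈A-vars : ∀ {x} → x ∈v̅ A → x ∈ A-vars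
  ∈v̅⇒∈A-vars (i , p) = ∈-concatMap⁺ varsᴬ {allFin n} (lose (∈-allFin i) (∈vᴸ⇒∈varsᴸ p))

  ∈A-vars⇒∈v̅ : ∀ {x} → x ∈ A-vars → x ∈v̅ A
  ∈A-vars⇒∈v̅ m with find (∈-concatMap⁻ varsᴬ {allFin n} m)
  ... | i , _ , p = i , ∈varsᴸ⇒∈vᴸ _ p

  x₀ : ℕ
  x₀ = argmax depth₀ (proj₁ A-nonground) A-vars

  d₀ : Maybe ℕ
  d₀ = depth₀ x₀

  x₀∈A : x₀ ∈v̅ A
  x₀∈A = argmax-all depth₀ (proj₂ A-nonground) (All.tabulate ∈A-vars⇒∈v̅)

  depth₀≤d₀ : ∀ {y} → y ∈v̅ A → depth₀ y ≤₋ d₀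
  depth₀≤d₀ p = All.lookup (f[xs]≤f[argmax] (proj₁ A-nonground) A-vars) (∈v̅⇒∈A-vars p)

  top⁺ : ∀ {x} → x ∈v̅ A → d₀ ≤₋ depth₀ x → Top A σ₀ x
  top⁺ p le = p , λ y q → toℤ-mono-≤ (≤₋-trans (depth₀≤d₀ q) le)

  top⁻ : ∀ {x} → Top A σ₀ x → d₀ ≤₋ depth₀ x
  top⁻ {x} (_ , h) = toℤ-cancel-≤ d₀ (depth₀ x) (h x₀ x₀∈A)

  top? : ∀ v → Dec (Top A σ₀ v)
  top? v = map′ (λ (p , le) → top⁺ p le) (λ t → proj₁ t , top⁻ t)
                (∈v̅? v A ×-dec ≤₋-dec ℕ._≤?_ d₀ (depth₀ v))

  θ : Subst {F}
  θ = flattenOn top? σ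

  -- Here σ₀ is ground on var(A̅), so the top pairs are those with non-ground Aⱼ. Patching σ
  -- with σ₀ on the variables of the other pairs unifies every pair, hence is an instance of σ₀.
  module TopGround (d₀≡nothing : d₀ ≡ nothing) where

    σ₀-ground : ∀ {y} → y ∈v̅ A → Ground (σ₀ y)
    σ₀-ground p = vdpM≡nothing⇒ground _ (below-nothing (subst (_ ≤₋_) d₀≡nothing (depth₀≤d₀ p)))
      where below-nothing : ∀ {a} → a ≤₋ nothing → a ≡ nothing
            below-nothing (⊥₋≤ _) = refl

    occurs⇒HasTop : ∀ {i x} → x ∈vA A i → HasTop A σ₀ i
    occurs⇒HasTop {i} p = _ , p , top⁺ (i , p) (subst (_≤₋ _) (sym d₀≡nothing) (⊥₋≤ _))

    Frozen : ℕ → Set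
    Frozen v = ∃ λ j → v ∈vA B j × GroundA (A j)

    Frozen? : ∀ v → Dec (Frozen v)
    Frozen? v = Fin.any? (λ j → ∈vA? v (B j) ×-dec GroundA? (A j))

    A-var-unfrozen : ∀ {v} → v ∈v̅ A → ¬ Frozen v
    A-var-unfrozen p (j , q , _) = B-var∉A j q p

    top-side-var-unfrozen : ∀ {i v} → HasTop A σ₀ i → v ∈vA B i → ¬ Frozen v
    top-side-var-unfrozen {i} (x , p , _) q (j , r , gA) with j Fin.≟ i
    ... | yes refl = gA x p
    ... | no j≢i = B-disjoint j i j≢i _ r q

    θ₀ : Subst {F}
    θ₀ v with Frozen? v
    ... | yes _ = σ₀ v
    ... | no _ = σ v

    θ₀-frozen : ∀ {v} → Frozen v → θ₀ v ≡ σ₀ v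
    θ₀-frozen {v} p with Frozen? v
    ... | yes _ = refl
    ... | no ¬p = ⊥-elim (¬p p)

    θ₀-unfrozen : ∀ {v} → ¬ Frozen v → θ₀ v ≡ σ v
    θ₀-unfrozen {v} ¬p with Frozen? v
    ... | yes p = ⊥-elim (¬p p)
    ... | no _ = refl

    θ₀-unifies : Unifies (λ _ → ⊤) A B θ₀
    θ₀-unifies j _ with groundA⊎occurs (A j)
    ... | inj₁ gA = begin
      A j [ θ₀ ]ᵃ   ≡⟨ groundA⇒[]ᵃ≡ (A j) θ₀ gA ⟩
      A j           ≡⟨ sym (groundA⇒[]ᵃ≡ (A j) σ₀ gA) ⟩
      A j [ σ₀ ]ᵃ   ≡⟨ proj₁ σ₀-mgu j tt ⟩
      B j [ σ₀ ]ᵃ   ≡⟨ []ᵃ-cong (B j) (λ v p → sym (θ₀-frozen (j , p , gA))) ⟩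
      B j [ θ₀ ]ᵃ   ∎
      where open ≡-Reasoning
    ... | inj₂ (x , p) = begin
      A j [ θ₀ ]ᵃ   ≡⟨ []ᵃ-cong (A j) (λ v q → θ₀-unfrozen (A-var-unfrozen (j , q))) ⟩
      A j [ σ ]ᵃ    ≡⟨ proj₁ mgu j h ⟩
      B j [ σ ]ᵃ    ≡⟨ []ᵃ-cong (B j) (λ v q → sym (θ₀-unfrozen (top-side-var-unfrozen h q))) ⟩
      B j [ θ₀ ]ᵃ   ∎
      where
        open ≡-Reasoning
        h : HasTop A σ₀ j
        h = occurs⇒HasTop p

    σ-ground : ∀ {y} → y ∈v̅ A → Ground (σ y)
    σ-ground {y} p with proj₂ σ₀-mgu θ₀ θ₀-unifies
    ... | η , θ₀≡σ₀η = subst Ground (begin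
      σ₀ y          ≡⟨ sym (ground⇒[]≡ η (σ₀-ground p)) ⟩
      σ₀ y [ η ]    ≡⟨ sym (θ₀≡σ₀η y) ⟩
      θ₀ y          ≡⟨ θ₀-unfrozen (A-var-unfrozen p) ⟩
      σ y           ∎) (σ₀-ground p)
      where open ≡-Reasoning

  module TopNonground {d : ℕ} (d₀≡just : d₀ ≡ just d) where

    depth₀≤d : ∀ {y} → y ∈v̅ A → depth₀ y ≤₋ just d
    depth₀≤d p = subst (_ ≤₋_) d₀≡just (depth₀≤d₀ p)

    top⇒deep : ∀ {x} → Top A σ₀ x → just d ≤₋ depth₀ x
    top⇒deep t = subst (_≤₋ _) d₀≡just (top⁻ t)

    deep⇒top : ∀ {x} → x ∈v̅ A → just d ≤₋ depth₀ x → Top A σ₀ x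
    deep⇒top p le = top⁺ p (subst (_≤₋ _) (sym d₀≡just) le)

    deep⇒nonground : ∀ {x} → just d ≤₋ depth₀ x → ¬ Ground (σ₀ x)
    deep⇒nonground le g = just≰₋nothing (subst (just d ≤₋_) (ground⇒vdpM≡nothing _ g) le)

    -- A side variable u lies in the non-ground compound argument t that B-shape provides,
    -- and t is matched by a main-premise argument: a ground one makes σ₀ u ground, a
    -- variable y gives depth₀ y > depth₀ u ≥ d.
    deep-var∉B-args : ∀ {i u} → just d ≤₋ depth₀ u → ¬ var u ∈ args (B i)
    deep-var∉B-args {i} {u} le u∈ with B-shape i
    ... | inj₂ gB = gB u (var u , u∈ , here)
    ... | inj₁ (t , t∈ , s , s⊑t , (_ , _ , refl) , s-ng) with shape i t∈
    ...   | ground-arg gt = s-ng (λ y q → gt y (∈v-⊑ s⊑t q))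
    ...   | var-arg w with ⊑var⇒≡ s⊑t
    ...     | ()
    deep-var∉B-args {i} {u} le u∈ | inj₁ (_ , t∈ , _) | covering-arg (covering f cs _ _ covers)
      with Pointwise-∈ (Pointwise.symmetric sym (σ₀-args i)) t∈
    ... | a , a∈ , t≡a with A-arg-ground⊎var i a∈
    ...   | inj₁ ga = deep⇒nonground le
            (ground-[]⁻ (fn f cs) (≡ground-[] σ₀ ga t≡a) u∈t)
      where u∈t = covers u (var u , u∈ , here)
    ...   | inj₂ (y , refl) = just≤₋⇒suc₋≰₋just le (begin
          suc₋ (depth₀ u)       ≤⟨ vdpM-[]-strict f cs (covers u (var u , u∈ , here)) ⟩
          vdpM (fn f cs [ σ₀ ]) ≡⟨ cong vdpM t≡a ⟩
          depth₀ y              ≤⟨ depth₀≤d (i , var y , a∈ , here) ⟩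
          just d                ∎)
      where open ≤₋-Reasoning

    deep-partner-covering : ∀ {i x b} → just d ≤₋ depth₀ x → b ∈ args (B i) → σ₀ x ≡ b [ σ₀ ] →
                            Covering i b
    deep-partner-covering {i} le b∈ e with shape i b∈
    ... | ground-arg gb = ⊥-elim (deep⇒nonground le (≡ground-[] σ₀ gb e))
    ... | var-arg u = ⊥-elim (deep-var∉B-args (subst (λ t → just d ≤₋ vdpM t) e le) b∈)
    ... | covering-arg c = c

    top-partner : ∀ {i x} → x ∈vA A i → Top A σ₀ x →
      ∃ λ b → b ∈ args (B i) × σ₀ x ≡ b [ σ₀ ] × σ x ≡ b [ σ ] × Covering i b
    top-partner {i} p t with Pointwise-∈ (σ₀σ-args i (_ , p , t)) (var∈A-args i p)
    ... | b , b∈ , e₀ , e = b , b∈ , e₀ , e , deep-partner-covering (top⇒deep t) b∈ e₀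

    side-var-shallow : ∀ {i w} → HasTop A σ₀ i → w ∈vA B i → suc₋ (depth₀ w) ≤₋ just d
    side-var-shallow {w = w} (x , p , t) q with top-partner p t
    ... | .(fn f cs) , _ , e₀ , _ , covering f cs _ _ covers = begin
      suc₋ (depth₀ w)        ≤⟨ vdpM-[]-strict f cs (covers w q) ⟩
      vdpM (fn f cs [ σ₀ ])  ≡⟨ cong vdpM e₀ ⟨
      depth₀ x               ≤⟨ depth₀≤d (_ , p) ⟩
      just d                 ∎
      where open ≤₋-Reasoning

    covering-partner-deep : ∀ {i y b} → HasTop A σ₀ i → b ∈ args (B i) → σ₀ y ≡ b [ σ₀ ] →
                            Covering i b → just d ≤₋ depth₀ y
    covering-partner-deep {y = y} (x , p , t) b∈ e (covering g ds _ _ covers-b) with top-partner p t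
    ... | .(fn f cs) , bₓ∈ , eₓ , _ , covering f cs _ flat _ = begin
      just d                 ≤⟨ top⇒deep t ⟩
      depth₀ x               ≡⟨ cong vdpM eₓ ⟩
      vdpM (fn f cs [ σ₀ ])  ≤⟨ vdpM-[]-shallow≤compound f cs (fn g ds) flat (g , ds , refl)
                                  (λ w q → covers-b w (fn f cs , bₓ∈ , q)) ⟩
      vdpM (fn g ds [ σ₀ ])  ≡⟨ cong vdpM e ⟨
      depth₀ y               ∎
      where open ≤₋-Reasoning

    var-arg-unified : ∀ {i y b} → HasTop A σ₀ i → var y ∈ args (A i) → b ∈ args (B i) →
      σ₀ y ≡ b [ σ₀ ] → σ y ≡ b [ σ ] → ¬ Ground (σ y) → θ y ≡ b [ θ ]
    var-arg-unified {i} {y} h a∈ b∈ e₀ e ng with shape i b∈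
    ... | ground-arg gb = ⊥-elim (ng (≡ground-[] σ gb e))
    ... | var-arg u = begin
      θ y             ≡⟨ flattenOn-∉ top? σ y-not-top ⟩
      flatten (σ y)   ≡⟨ cong flatten e ⟩
      flatten (σ u)   ≡⟨ flattenOn-∉ top? σ u-not-top ⟨
      θ u             ∎
      where
        open ≡-Reasoning
        y-not-top : ¬ Top A σ₀ y
        y-not-top t = just≤₋⇒suc₋≰₋just (subst (λ t → just d ≤₋ vdpM t) e₀ (top⇒deep t))
                        (side-var-shallow h (var u , b∈ , here))
        u-not-top : ¬ Top A σ₀ u
        u-not-top t = B-var∉A i (var u , b∈ , here) (proj₁ t)
    ... | covering-arg cov@(covering f cs _ flat _) = begin
      θ y                       ≡⟨ flattenOn-∈ top? σ y-top ⟩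
      flatten₁ (σ y)            ≡⟨ cong flatten₁ e ⟩
      flatten₁ (fn f cs [ σ ])  ≡⟨ []-flatten₁ f cs args-flattened ⟨
      fn f cs [ θ ]             ∎
      where
        open ≡-Reasoning
        y-top : Top A σ₀ y
        y-top = deep⇒top (i , var y , a∈ , here)
                  (covering-partner-deep h b∈ e₀ cov)
        args-flattened : ∀ c → c ∈ cs → c [ θ ] ≡ flatten (c [ σ ])
        args-flattened c c∈ with flat c c∈
        ... | inj₁ gc = trans (ground⇒[]≡ θ gc)
                          (sym (trans (cong flatten (ground⇒[]≡ σ gc)) (flatten-ground c gc)))
        ... | inj₂ (w , refl) =
          flattenOn-∉ top? σ (λ t → B-var∉A i (fn f cs , b∈ , there here c∈) (proj₁ t))

  d₀-cases : d₀ ≡ nothing ⊎ ∃ λ d → d₀ ≡ just d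
  d₀-cases with d₀
  ... | nothing = inj₁ refl
  ... | just d = inj₂ (d , refl)

  θ-unifies : Unifies (HasTop A σ₀) A B θ
  θ-unifies i h =
    ArgsUnified⇒[]ᵃ≡ θ (cong pred (proj₁ σ₀-mgu i tt)) (Pointwise-map-∈ unified (σ₀σ-args i h))
    where
      unified : ∀ {a b} → a ∈ args (A i) → b ∈ args (B i) →
                a [ σ₀ ] ≡ b [ σ₀ ] × a [ σ ] ≡ b [ σ ] → a [ θ ] ≡ b [ θ ]
      unified {a} {b} a∈ b∈ (e₀ , e) with ground⊎occurs (a [ σ ])
      ... | inj₁ g = trans (flattenOn-[]-ground top? σ a g)
                       (trans e (sym (flattenOn-[]-ground top? σ b (subst Ground e g))))
      ... | inj₂ (z , z∈) with A-arg-ground⊎var i a∈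
      ...   | inj₁ ga = ⊥-elim (≡ground-[] σ ga refl z z∈)
      ...   | inj₂ (y , refl) with d₀-cases
      ...     | inj₁ d₀≡ = ⊥-elim (TopGround.σ-ground d₀≡ (i , var y , a∈ , here) z z∈)
      ...     | inj₂ (_ , d₀≡) = TopNonground.var-arg-unified d₀≡ h a∈ b∈ e₀ e (λ g → g z z∈)

  non-top-var⊎ground : ∀ v → ¬ Top A σ₀ v → IsVar (σ v) ⊎ Ground (σ v)
  non-top-var⊎ground = mgu-flattenOn top? mgu θ-unifies

  top-simple⊎ground : ∀ x → Top A σ₀ x →
    (IsCompound (σ x) × ¬ Ground (σ x) × vdp (σ x) ≡ + 1) ⊎ Ground (σ x)
  top-simple⊎ground x t with ground⊎occurs (σ x) | d₀-cases
  ... | inj₁ g | _ = inj₂ g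
  ... | inj₂ _ | inj₁ d₀≡ = inj₂ (TopGround.σ-ground d₀≡ (proj₁ t))
  ... | inj₂ (z , z∈) | inj₂ (_ , d₀≡) with TopNonground.top-partner d₀≡ (proj₂ (proj₁ t)) t
  ...   | .(fn f cs) , b∈ , _ , e , covering f cs _ flat _ =
    inj₁ ((f , cs [ σ ]* , e) , ng , cong toℤ (trans (cong vdpM e)
      (vdpM-[]-shallow f cs σ flat args-flat (subst (¬_ ∘ Ground) e ng))))
    where
      ng : ¬ Ground (σ x)
      ng g = g z z∈
      args-flat : ∀ w → var w ∈ cs → Ground (σ w) ⊎ IsVar (σ w)
      args-flat w w∈ =
        swap (non-top-var⊎ground w (λ t → B-var∉A _ (fn f cs , b∈ , there here w∈) (proj₁ t)))

lemma4 : {F P : Set} {n : ℕ}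
    (A B : Fin n → Atom F P) (σ₀ : Subst {F}) → QueryPair n A B σ₀ →
    (D : Clause F P) (Ds : Fin n → Clause F P) →
    FlatC D → (∀ i → SimpleC (Ds i)) →
    (∀ i → HasTop A σ₀ i → ∀ x → x ∈vC mainClause A D → ¬ (x ∈vC sideClause (B i) (Ds i))) →
    (σ : Subst {F}) → IsMGU (HasTop A σ₀) A B σ →
    (∀ x → Top A σ₀ x →
       (IsCompound (σ x) × ¬ Ground (σ x) × vdp (σ x) ≡ + 1) ⊎ Ground (σ x))
    × (∀ x → x ∈vC mainClause A D → ¬ Top A σ₀ x → IsVar (σ x) ⊎ Ground (σ x))
    × (∀ i → HasTop A σ₀ i → ∀ x → x ∈vC sideClause (B i) (Ds i) →
       IsVar (σ x) ⊎ Ground (σ x))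
lemma4 A B σ₀ qp D Ds _ _ disjoint σ mgu =
  top-simple⊎ground , (λ x _ → non-top-var⊎ground x) , side-var⊎ground
  where
    open QueryPairAnalysis qp mgu
    side-var⊎ground : ∀ i → HasTop A σ₀ i → ∀ x → x ∈vC sideClause (B i) (Ds i) →
                      IsVar (σ x) ⊎ Ground (σ x)
    side-var⊎ground i h x x∈ =
      non-top-var⊎ground x (λ t → disjoint i h x (∈v̅⇒∈vC-mainClause A D (proj₁ t)) x∈)
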